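{- There is a function $d\colon \mathbb{N} \rightarrow \mathbb{N}$, satisfying Kraft's inequality tightly (i.e. $\sum_{n=0}^\infty 2^{ -d(n)} = 1$), such that $c \not\preceq d$ for any code $c$.
   Context: A precode is a monotone non-decreasing function $c\colon \mathbb{N}\to\mathbb{N}$ satisfying Kraft's inequality $\sum_{n=0}^\infty 2^{ -c(n)} \le 1$; a code is a precode for which this inequality is tight (equality holds). For functions $c,d\colon\mathbb{N}\to\mathbb{N}$, $c \preceq d$ means $\sup_{n} (c(n) - d(n)) < \infty$, and $c \not\preceq d$ means this fails. Here $\mathbb{N}$ includes zero. The function $d$ in the claim is not required to be monotone. -}

module Defs where

open import Data.Nat using (ℕ; zero; suc; _≤_; _+_)
open import Data.Product using (Σ; ∃; _×_)
open import Relation.Nullary using (¬_)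
open import Data.Rational using (ℚ; 0ℚ; 1ℚ; ½; _-_; ∣_∣; Positive)
  renaming (_+_ to _+ℚ_; _*_ to _*ℚ_; _≤_ to _≤ℚ_)

pow½ : ℕ → ℚ
pow½ zero    = 1ℚ
pow½ (suc k) = ½ *ℚ pow½ k

kraftSum : (ℕ → ℕ) → ℕ → ℚ
kraftSum c zero    = 0ℚ
kraftSum c (suc N) = kraftSum c N +ℚ pow½ (c N)

Monotone : (ℕ → ℕ) → Set
Monotone c = ∀ m n → m ≤ n → c m ≤ c n

-- Σ_{n=0}^∞ 2^{-c(n)} ≤ 1  (series of nonnegative terms: all partial sums ≤ 1)
KraftIneq : (ℕ → ℕ) → Set
KraftIneq c = ∀ N → kraftSum c N ≤ℚ 1ℚ

KraftTight : (ℕ → ℕ) → Set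
KraftTight c = ∀ (ε : ℚ) → Positive ε →
  ∃ λ N → ∀ M → N ≤ M → ∣ kraftSum c M - 1ℚ ∣ ≤ℚ ε

Precode : (ℕ → ℕ) → Set
Precode c = Monotone c × KraftIneq c

Code : (ℕ → ℕ) → Set
Code c = Precode c × KraftTight c

-- c ⪯ d  iff  sup_n (c n - d n) < ∞, i.e. ∃ B ∈ ℕ, ∀ n, c n ≤ d n + B
_⪯_ : (ℕ → ℕ) → (ℕ → ℕ) → Set
c ⪯ d = ∃ λ B → ∀ n → c n ≤ d n + B

-- The sequence d is laid out in blocks: block k is one entry k + 2 followed by 4^k entries 3k + 2,
-- so it contributes 2^-(k+2) + 4^k 2^-(3k+2) = 2^-(k+1), and the blocks sum to 1.
-- The head of block k + 1, of length k + 3, comes after more than 4^k entries. If c is monotone and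
-- c ≤ d + B, then all these entries of c are at most K = k + 3 + B, and for k = B + 3 there are
-- more than 2^K of them, each contributing at least 2^-K to the Kraft sum of c, which exceeds 1.
module Submission where

open import Defs
open import Data.Nat using (ℕ; zero; suc; _+_; _*_; _^_; _≤_; _<_; z≤n; s≤s; s≤s⁻¹; _∸_; NonZero)
import Data.Nat.Properties as ℕ
open import Data.Nat.Coprimality using (coprime⇒gcd≡1; 1-coprimeTo)
open import Data.Nat.GCD using (gcd)
open import Data.Product using (Σ; ∃; _×_; _,_; proj₁; proj₂)
open import Data.Sum using (inj₁; inj₂)
open import Relation.Nullary using (¬_)
open import Relation.Binary.PropositionalEquality
open import Data.Integer as ℤ using (+_; +[1+_])
import Data.Integer.Properties as ℤ
open import Data.Rational using (0ℚ; 1ℚ; ½; mkℚ; ↥_; ↧_; ↧ₙ_; _/_; Positive; *≤*; *<*)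
  renaming (_+_ to _+ℚ_; _*_ to _*ℚ_; _≤_ to _≤ℚ_; _<_ to _<ℚ_; -_ to -ℚ_; _-_ to _-ℚ_; ∣_∣ to ∣_∣ℚ)
import Data.Rational.Properties as ℚ
open import Data.Rational.Solver using (module +-*-Solver)

pow½-pos : ∀ k → 0ℚ <ℚ pow½ k
pow½-pos zero    = *<* (ℤ.+<+ (s≤s z≤n))
pow½-pos (suc k) = subst (_<ℚ ½ *ℚ pow½ k) (ℚ.*-zeroʳ ½) (ℚ.*-monoʳ-<-pos ½ (pow½-pos k))

pow½-nonNeg : ∀ k → 0ℚ ≤ℚ pow½ k
pow½-nonNeg k = ℚ.<⇒≤ (pow½-pos k)

pow½-suc+pow½-suc : ∀ k → pow½ (suc k) +ℚ pow½ (suc k) ≡ pow½ k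
pow½-suc+pow½-suc k = trans (sym (ℚ.*-distribʳ-+ (pow½ k) ½ ½)) (ℚ.*-identityˡ (pow½ k))

x≤x+y : ∀ x {y} → 0ℚ ≤ℚ y → x ≤ℚ x +ℚ y
x≤x+y x {y} 0≤y = subst (_≤ℚ x +ℚ y) (ℚ.+-identityʳ x) (ℚ.+-monoʳ-≤ x 0≤y)

pow½-antitone : ∀ {k j} → k ≤ j → pow½ j ≤ℚ pow½ k
pow½-antitone {k} {j} k≤j = subst (λ i → pow½ i ≤ℚ pow½ k) (ℕ.m+[n∸m]≡n k≤j) (go k (j ∸ k))
  where
  go : ∀ k i → pow½ (k + i) ≤ℚ pow½ k
  go k zero    = ℚ.≤-reflexive (cong pow½ (ℕ.+-identityʳ k))
  go k (suc i) = begin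
    pow½ (k + suc i)                         ≡⟨ cong pow½ (ℕ.+-suc k i) ⟩
    pow½ (suc (k + i))                       ≤⟨ x≤x+y _ (pow½-nonNeg (suc (k + i))) ⟩
    pow½ (suc (k + i)) +ℚ pow½ (suc (k + i)) ≡⟨ pow½-suc+pow½-suc (k + i) ⟩
    pow½ (k + i)                             ≤⟨ go k i ⟩
    pow½ k                                   ∎
    where open ℚ.≤-Reasoning

kraftSum-mono : ∀ f {N M} → N ≤ M → kraftSum f N ≤ℚ kraftSum f M
kraftSum-mono f {N} {M} N≤M = subst (λ L → kraftSum f N ≤ℚ kraftSum f L) (ℕ.m+[n∸m]≡n N≤M) (go N (M ∸ N))
  where
  go : ∀ N i → kraftSum f N ≤ℚ kraftSum f (N + i)
  go N zero    = ℚ.≤-reflexive (cong (kraftSum f) (sym (ℕ.+-identityʳ N)))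
  go N (suc i) rewrite ℕ.+-suc N i = ℚ.≤-trans (go N i) (x≤x+y _ (pow½-nonNeg (f (N + i))))

kraftSum-+ : ∀ f N L → kraftSum f (N + L) ≡ kraftSum f N +ℚ kraftSum (λ n → f (N + n)) L
kraftSum-+ f N zero    rewrite ℕ.+-identityʳ N = sym (ℚ.+-identityʳ (kraftSum f N))
kraftSum-+ f N (suc L) rewrite ℕ.+-suc N L =
  trans (cong (_+ℚ pow½ (f (N + L))) (kraftSum-+ f N L)) (ℚ.+-assoc (kraftSum f N) _ _)

kraftSum-cong : ∀ {f g} N → (∀ n → n < N → f n ≡ g n) → kraftSum f N ≡ kraftSum g N
kraftSum-cong zero    f≡g = refl
kraftSum-cong (suc N) f≡g =
  cong₂ _+ℚ_ (kraftSum-cong N (λ n n<N → f≡g n (ℕ.m≤n⇒m≤1+n n<N))) (cong pow½ (f≡g N ℕ.≤-refl))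

kraftSum-antitone : ∀ {f g} N → (∀ n → n < N → f n ≤ g n) → kraftSum g N ≤ℚ kraftSum f N
kraftSum-antitone zero    f≤g = ℚ.≤-refl
kraftSum-antitone (suc N) f≤g =
  ℚ.+-mono-≤ (kraftSum-antitone N (λ n n<N → f≤g n (ℕ.m≤n⇒m≤1+n n<N))) (pow½-antitone (f≤g N ℕ.≤-refl))

kraftSum-const : ∀ a b → kraftSum (λ _ → a + b) (2 ^ a) ≡ pow½ b
kraftSum-const zero    b = ℚ.+-identityˡ (pow½ b)
kraftSum-const (suc a) b = begin
  kraftSum (λ _ → suc a + b) (2 ^ a + (2 ^ a + 0))
    ≡⟨ cong (λ L → kraftSum (λ _ → suc a + b) (2 ^ a + L)) (ℕ.+-identityʳ (2 ^ a)) ⟩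
  kraftSum (λ _ → suc a + b) (2 ^ a + 2 ^ a)
    ≡⟨ kraftSum-+ (λ _ → suc a + b) (2 ^ a) (2 ^ a) ⟩
  S +ℚ S
    ≡⟨ cong₂ _+ℚ_ half half ⟩
  pow½ (suc b) +ℚ pow½ (suc b)
    ≡⟨ pow½-suc+pow½-suc b ⟩
  pow½ b
    ∎
  where
  open ≡-Reasoning
  S = kraftSum (λ _ → suc a + b) (2 ^ a)
  half : S ≡ pow½ (suc b)
  half = trans (kraftSum-cong (2 ^ a) (λ _ _ → sym (ℕ.+-suc a b))) (kraftSum-const a (suc b))

fillerLength : ℕ → ℕ
fillerLength k = 2 ^ (k + k)

fillerValue : ℕ → ℕ
fillerValue k = (k + k) + suc (suc k)

blockLength : ℕ → ℕ
blockLength k = suc (fillerLength k)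

-- fromBlock k n is d (blockStart k + n); filler k r n is the entry n places after the point of
-- block k where r filler entries remain.
mutual
  fromBlock : ℕ → ℕ → ℕ
  fromBlock k zero    = suc (suc k)
  fromBlock k (suc n) = filler k (fillerLength k) n

  filler : ℕ → ℕ → ℕ → ℕ
  filler k zero    n       = fromBlock (suc k) n
  filler k (suc r) zero    = fillerValue k
  filler k (suc r) (suc n) = filler k r n

d : ℕ → ℕ
d = fromBlock 0

blockStart : ℕ → ℕ
blockStart zero    = 0
blockStart (suc k) = blockStart k + blockLength k

filler-value : ∀ k r n → n < r → filler k r n ≡ fillerValue k
filler-value k (suc r) zero    _         = refl
filler-value k (suc r) (suc n) (s≤s n<r) = filler-value k r n n<r

filler-skip : ∀ k r n → filler k r (r + n) ≡ fromBlock (suc k) n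
filler-skip k zero    n = refl
filler-skip k (suc r) n = filler-skip k r n

d-blockStart : ∀ k n → d (blockStart k + n) ≡ fromBlock k n
d-blockStart zero    n = refl
d-blockStart (suc k) n = begin
  d (blockStart k + blockLength k + n)           ≡⟨ cong d (ℕ.+-assoc (blockStart k) (blockLength k) n) ⟩
  d (blockStart k + (blockLength k + n))         ≡⟨ d-blockStart k (blockLength k + n) ⟩
  filler k (fillerLength k) (fillerLength k + n) ≡⟨ filler-skip k (fillerLength k) n ⟩
  fromBlock (suc k) n                            ∎
  where open ≡-Reasoning

kraftSum-block : ∀ k → kraftSum (fromBlock k) (blockLength k) ≡ pow½ (suc k)
kraftSum-block k = begin
  kraftSum (fromBlock k) (1 + fillerLength k)
    ≡⟨ kraftSum-+ (fromBlock k) 1 (fillerLength k) ⟩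
  (0ℚ +ℚ h) +ℚ kraftSum (filler k (fillerLength k)) (fillerLength k)
    ≡⟨ cong₂ _+ℚ_ (ℚ.+-identityˡ h) (kraftSum-cong (fillerLength k) (filler-value k (fillerLength k))) ⟩
  h +ℚ kraftSum (λ _ → fillerValue k) (fillerLength k)
    ≡⟨ cong (h +ℚ_) (kraftSum-const (k + k) (suc (suc k))) ⟩
  h +ℚ h
    ≡⟨ pow½-suc+pow½-suc (suc k) ⟩
  pow½ (suc k)
    ∎
  where
  open ≡-Reasoning
  h = pow½ (suc (suc k))

kraftSum-d-blockStart : ∀ k → kraftSum d (blockStart k) +ℚ pow½ k ≡ 1ℚ
kraftSum-d-blockStart zero    = ℚ.+-identityˡ 1ℚ
kraftSum-d-blockStart (suc k) = begin
  kraftSum d (blockStart k + blockLength k) +ℚ pow½ (suc k)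
    ≡⟨ cong (_+ℚ pow½ (suc k)) (kraftSum-+ d (blockStart k) (blockLength k)) ⟩
  (S +ℚ kraftSum (λ n → d (blockStart k + n)) (blockLength k)) +ℚ pow½ (suc k)
    ≡⟨ cong (λ x → (S +ℚ x) +ℚ pow½ (suc k))
         (trans (kraftSum-cong (blockLength k) (λ n _ → d-blockStart k n)) (kraftSum-block k)) ⟩
  (S +ℚ pow½ (suc k)) +ℚ pow½ (suc k)   ≡⟨ ℚ.+-assoc S _ _ ⟩
  S +ℚ (pow½ (suc k) +ℚ pow½ (suc k))   ≡⟨ cong (S +ℚ_) (pow½-suc+pow½-suc k) ⟩
  S +ℚ pow½ k                           ≡⟨ kraftSum-d-blockStart k ⟩
  1ℚ                                    ∎
  where
  open ≡-Reasoning
  S = kraftSum d (blockStart k)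

k≤blockStart : ∀ k → k ≤ blockStart k
k≤blockStart zero    = z≤n
k≤blockStart (suc k) = begin
  suc k                                ≤⟨ s≤s (k≤blockStart k) ⟩
  suc (blockStart k)                   ≤⟨ ℕ.m≤n+m (suc (blockStart k)) (fillerLength k) ⟩
  fillerLength k + suc (blockStart k)  ≡⟨ ℕ.+-comm (fillerLength k) (suc (blockStart k)) ⟩
  suc (blockStart k) + fillerLength k  ≡⟨ sym (ℕ.+-suc (blockStart k) (fillerLength k)) ⟩
  blockStart (suc k)                   ∎
  where open ℕ.≤-Reasoning

d-kraftIneq : KraftIneq d
d-kraftIneq N = begin
  kraftSum d N                          ≤⟨ kraftSum-mono d (k≤blockStart N) ⟩
  kraftSum d (blockStart N)             ≤⟨ x≤x+y _ (pow½-nonNeg N) ⟩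
  kraftSum d (blockStart N) +ℚ pow½ N   ≡⟨ kraftSum-d-blockStart N ⟩
  1ℚ                                    ∎
  where open ℚ.≤-Reasoning

d-kraftTail : ∀ k {N} → blockStart k ≤ N → 1ℚ ≤ℚ kraftSum d N +ℚ pow½ k
d-kraftTail k {N} bs≤N =
  subst (_≤ℚ kraftSum d N +ℚ pow½ k) (kraftSum-d-blockStart k) (ℚ.+-monoˡ-≤ (pow½ k) (kraftSum-mono d bs≤N))

∣x-y∣≤r : ∀ {x y r} → 0ℚ ≤ℚ r → x ≤ℚ y → y ≤ℚ x +ℚ r → ∣ x -ℚ y ∣ℚ ≤ℚ r
∣x-y∣≤r {x} {y} {r} 0≤r x≤y y≤x+r with ℚ.∣p∣≡p∨∣p∣≡-p (x -ℚ y)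
... | inj₁ ∣x-y∣≡x-y = begin
  ∣ x -ℚ y ∣ℚ ≡⟨ ∣x-y∣≡x-y ⟩
  x -ℚ y      ≤⟨ ℚ.+-monoˡ-≤ (-ℚ y) x≤y ⟩
  y -ℚ y      ≡⟨ ℚ.+-inverseʳ y ⟩
  0ℚ          ≤⟨ 0≤r ⟩
  r           ∎
  where open ℚ.≤-Reasoning
... | inj₂ ∣x-y∣≡y-x = begin
  ∣ x -ℚ y ∣ℚ      ≡⟨ ∣x-y∣≡y-x ⟩
  -ℚ (x -ℚ y)      ≡⟨ solve 2 (λ x y → :- (x :- y) := y :- x) refl x y ⟩
  y -ℚ x           ≤⟨ ℚ.+-monoˡ-≤ (-ℚ x) y≤x+r ⟩
  (x +ℚ r) -ℚ x    ≡⟨ solve 2 (λ x r → (x :+ r) :- x := r) refl x r ⟩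
  r                ∎
  where
  open ℚ.≤-Reasoning
  open +-*-Solver

n≤2^n : ∀ n → n ≤ 2 ^ n
n≤2^n zero    = z≤n
n≤2^n (suc n) = ℕ.+-mono-≤ (ℕ.m^n>0 2 n) (ℕ.≤-trans (n≤2^n n) (ℕ.m≤m+n (2 ^ n) 0))

↥1/n≡1×↧1/n≡n : ∀ n .{{_ : NonZero n}} → (↥ (+ 1 / n) ≡ + 1) × (↧ₙ (+ 1 / n) ≡ n)
↥1/n≡1×↧1/n≡n n = numerator , ℤ.+-injective denominator
  where
  gcd[1,n]≡1 : + gcd 1 n ≡ + 1
  gcd[1,n]≡1 = cong +_ (coprime⇒gcd≡1 (1-coprimeTo n))
  numerator : ↥ (+ 1 / n) ≡ + 1
  numerator = trans (sym (ℤ.*-identityʳ _)) (trans (cong (↥ (+ 1 / n) ℤ.*_) (sym gcd[1,n]≡1)) (ℚ.↥-/ (+ 1) n))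
  denominator : ↧ (+ 1 / n) ≡ + n
  denominator = trans (sym (ℤ.*-identityʳ _)) (trans (cong (↧ (+ 1 / n) ℤ.*_) (sym gcd[1,n]≡1)) (ℚ.↧-/ (+ 1) n))

↥pow½≡1×↧pow½≡2^k : ∀ k → (↥ pow½ k ≡ + 1) × (↧ₙ pow½ k ≡ 2 ^ k)
↥pow½≡1×↧pow½≡2^k zero    = refl , refl
↥pow½≡1×↧pow½≡2^k (suc k) = half (pow½ k) (↥pow½≡1×↧pow½≡2^k k)
  where
  half : ∀ x {m} → (↥ x ≡ + 1) × (↧ₙ x ≡ m) → (↥ (½ *ℚ x) ≡ + 1) × (↧ₙ (½ *ℚ x) ≡ 2 * m)
  half (mkℚ _ den _) (refl , refl) = ↥1/n≡1×↧1/n≡n (2 * suc den)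

pow½-below-pos : ∀ ε → Positive ε → ∃ λ k → pow½ k ≤ℚ ε
pow½-below-pos (mkℚ +[1+ n ] e _) _ = suc e , *≤* (begin
  ↥ pow½ (suc e) ℤ.* + suc e  ≡⟨ cong (ℤ._* + suc e) (proj₁ (↥pow½≡1×↧pow½≡2^k (suc e))) ⟩
  + 1 ℤ.* + suc e             ≡⟨ ℤ.*-identityˡ (+ suc e) ⟩
  + suc e                     ≤⟨ ℤ.+≤+ (ℕ.≤-trans (n≤2^n (suc e)) (ℕ.m≤n*m (2 ^ suc e) (suc n))) ⟩
  + (suc n * 2 ^ suc e)       ≡⟨ ℤ.pos-* (suc n) (2 ^ suc e) ⟩
  +[1+ n ] ℤ.* + 2 ^ suc e    ≡⟨ cong (λ m → +[1+ n ] ℤ.* + m) (sym (proj₂ (↥pow½≡1×↧pow½≡2^k (suc e)))) ⟩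
  +[1+ n ] ℤ.* ↧ pow½ (suc e) ∎)
  where open ℤ.≤-Reasoning

d-kraftTight : KraftTight d
d-kraftTight ε ε>0 with pow½-below-pos ε ε>0
... | k , pow½k≤ε = blockStart k , λ N bs≤N →
  ℚ.≤-trans (∣x-y∣≤r (pow½-nonNeg k) (d-kraftIneq N) (d-kraftTail k bs≤N)) pow½k≤ε

d-blockStart-head : ∀ k → d (blockStart k) ≡ suc (suc k)
d-blockStart-head k = trans (cong d (sym (ℕ.+-identityʳ (blockStart k)))) (d-blockStart k 0)

fillerLength≤blockStart : ∀ k → fillerLength k ≤ blockStart (suc k)
fillerLength≤blockStart k = ℕ.≤-trans (ℕ.n≤1+n (fillerLength k)) (ℕ.m≤n+m (blockLength k) (blockStart k))

KraftIneq⇒¬≤K-upTo-2^K : ∀ {c} K → KraftIneq c → ¬ (∀ n → n ≤ 2 ^ K → c n ≤ K)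
KraftIneq⇒¬≤K-upTo-2^K {c} K kraft c≤K = ℚ.<-irrefl refl (begin-strict
  1ℚ                                         ≡⟨ sym (ℚ.+-identityʳ 1ℚ) ⟩
  1ℚ +ℚ 0ℚ                                   <⟨ ℚ.+-monoʳ-< 1ℚ (pow½-pos K) ⟩
  1ℚ +ℚ pow½ K                               ≡⟨ cong (_+ℚ pow½ K) (sym 2^K-terms) ⟩
  kraftSum (λ _ → K) (suc (2 ^ K))           ≤⟨ kraftSum-antitone (suc (2 ^ K)) (λ n n<1+2^K → c≤K n (s≤s⁻¹ n<1+2^K)) ⟩
  kraftSum c (suc (2 ^ K))                   ≤⟨ kraft (suc (2 ^ K)) ⟩
  1ℚ                                         ∎)
  where
  open ℚ.≤-Reasoning
  2^K-terms : kraftSum (λ _ → K) (2 ^ K) ≡ 1ℚ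
  2^K-terms = trans (kraftSum-cong (2 ^ K) (λ _ _ → sym (ℕ.+-identityʳ K))) (kraftSum-const K 0)

precode⋠d : ∀ c → Precode c → ¬ (c ⪯ d)
precode⋠d c (mono , kraft) (B , c≤d+B) = KraftIneq⇒¬≤K-upTo-2^K (k + k) kraft c≤2k
  where
  k = 3 + B
  P = blockStart (suc k)
  d[P]+B≡2k : d P + B ≡ k + k
  d[P]+B≡2k = trans (cong (_+ B) (d-blockStart-head (suc k))) (cong (λ m → 3 + m) (ℕ.+-comm k B))
  c≤2k : ∀ n → n ≤ 2 ^ (k + k) → c n ≤ k + k
  c≤2k n n≤4^k = ℕ.≤-trans (mono n P (ℕ.≤-trans n≤4^k (fillerLength≤blockStart k)))
                            (subst (c P ≤_) d[P]+B≡2k (c≤d+B P))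

lemma2p5 : Σ (ℕ → ℕ) λ d → KraftTight d × (∀ (c : ℕ → ℕ) → Code c → ¬ (c ⪯ d))
lemma2p5 = d , d-kraftTight , λ c code → precode⋠d c (proj₁ code)
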